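{- Let $k\geqslant2$ and $\delta>\frac{k-2}{k-1}$, and let $G$ be a graph on $n$ vertices with $\delta(G)\geqslant\delta n$. Define $\delta'=\delta-\frac{k-2}{k-1}$. Then every tight component $T$ of $K_k(G)$ satisfies $e(T)>\binom{\delta' n}{k}$.
   Context: $K_k(G)$ is the $k$-uniform hypergraph on $V(G)$ whose edges are the vertex sets of $k$-cliques of $G$. For a $k$-graph $J$, let $T(J)$ be the graph on vertex set $E(J)$ in which $e,f$ are adjacent iff $|e\cap f|=k-1$; the tight components of $J$ are the subhypergraphs of $J$ whose edge sets are the connected components of $T(J)$. For real $x$, $\binom{x}{k}=x(x-1)\cdots(x-k+1)/k!$.
   Formalization: The parameter $\delta$ ranges over the rationals. -}

module Defs where

open import Data.Bool using (Bool; true; false)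
open import Data.Nat using (ℕ; zero; suc; _∸_)
open import Data.Fin using (Fin)
open import Data.Fin.Subset using (Subset; _∈_; _∩_; ∣_∣)
open import Data.Vec using (tabulate)
open import Data.Integer using (+_)
open import Data.Rational using (ℚ; _/_; _*_; _-_; 1ℚ)
open import Data.Product using (_×_)
open import Relation.Binary.PropositionalEquality using (_≡_; _≢_)
open import Relation.Binary.Construct.Closure.ReflexiveTransitive using (Star)

record Graph (n : ℕ) : Set where
  field
    adj     : Fin n → Fin n → Bool
    sym     : ∀ u v → adj u v ≡ adj v u
    irrefl  : ∀ v → adj v v ≡ false
open Graph public

ℕtoℚ : ℕ → ℚ
ℕtoℚ m = + m / 1

deg : ∀ {n} → Graph n → Fin n → ℕ
deg G v = ∣ tabulate (adj G v) ∣

-- (k-2)/(k-1), used only for k ≥ 2 (arbitrary value 0 for k < 2)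
kfrac : ℕ → ℚ
kfrac zero = + 0 / 1
kfrac (suc zero) = + 0 / 1
kfrac (suc (suc m)) = + m / suc m

binomℚ : ℚ → ℕ → ℚ
binomℚ x zero = 1ℚ
binomℚ x (suc j) = binomℚ x j * ((x - ℕtoℚ j) * (+ 1 / suc j))

-- S is an edge of K_k(G): a k-element vertex set that is a clique of G
IsKClique : ∀ {n} → Graph n → ℕ → Subset n → Set
IsKClique G k S = (∣ S ∣ ≡ k) × (∀ u v → u ∈ S → v ∈ S → u ≢ v → adj G u v ≡ true)

TightAdj : ∀ {n} → Graph n → ℕ → Subset n → Subset n → Set
TightAdj G k e f = IsKClique G k e × IsKClique G k f × (∣ e ∩ f ∣ ≡ k ∸ 1)

InTightComponent : ∀ {n} → Graph n → ℕ → Subset n → Subset n → Set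
InTightComponent G k e f = Star (TightAdj G k) e f

{-# OPTIONS --safe #-}
-- Let d = n − D for the minimum degree D. Every (k−1)-set of vertices has at least n − (k−1)d
-- common neighbours, and δ′n ≤ n − (k−1)d =: a + 1.
-- Edges of the tight component of e are produced recursively from an edge S, a set F ⊆ S of
-- fixed vertices and a set X of forbidden vertices: for v ∈ S ∖ F, the edges containing v are
-- obtained by also fixing v, and the edges avoiding v by replacing v in S with a common
-- neighbour y ∉ X ∪ {v} of S − v (a tight step) and forbidding v. Forbidding a vertex costs at
-- most one common neighbour, so the number of edges found satisfies Pascal's recurrence and
-- reaches binom(a + k, k), which exceeds binom(x, k) for every rational 0 < x ≤ a + 1 because
-- |x − i| < a + 1 + i for i ≥ 1.
module Submission where

open import Defs renaming (sym to adj-sym)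

module FiniteSubsets where

  open import Data.Fin using (Fin; zero; suc)
  open import Data.Fin.Subset
  open import Data.Fin.Subset.Properties
  open import Data.Nat using (suc; _+_; _∸_; _≤_; _<_; s≤s)
  open import Data.Nat.Properties
  open import Data.Product using (∃-syntax; _×_; _,_; proj₂)
  open import Data.Sum using (_⊎_; inj₁; inj₂; [_,_]′)
  open import Data.Vec using ([]; _∷_; here; there)
  open import Function using (_∘_)
  open import Relation.Binary.PropositionalEquality
  open import Relation.Nullary using (contradiction)

  ∣p∣≤1+∣p-x∣ : ∀ {n} (p : Subset n) x → ∣ p ∣ ≤ suc ∣ p - x ∣
  ∣p∣≤1+∣p-x∣ (inside  ∷ p) zero    = s≤s (≤-reflexive (cong ∣_∣ (sym (p─⊥≡p p))))
  ∣p∣≤1+∣p-x∣ (outside ∷ p) zero    = ≤-trans (n≤1+n ∣ p ∣) (s≤s (≤-reflexive (cong ∣_∣ (sym (p─⊥≡p p)))))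
  ∣p∣≤1+∣p-x∣ (inside  ∷ p) (suc x) = s≤s (∣p∣≤1+∣p-x∣ p x)
  ∣p∣≤1+∣p-x∣ (outside ∷ p) (suc x) = ∣p∣≤1+∣p-x∣ p x

  x∈p⇒∣p∣≡1+∣p-x∣ : ∀ {n} {p : Subset n} {x} → x ∈ p → ∣ p ∣ ≡ suc ∣ p - x ∣
  x∈p⇒∣p∣≡1+∣p-x∣ {p = p} {x} x∈p = ≤-antisym (∣p∣≤1+∣p-x∣ p x) (x∈p⇒∣p-x∣<∣p∣ x∈p)

  x∈p⇒∣p-x∣≡∣p∣∸1 : ∀ {n} {p : Subset n} {x} → x ∈ p → ∣ p - x ∣ ≡ ∣ p ∣ ∸ 1
  x∈p⇒∣p-x∣≡∣p∣∸1 x∈p = cong (_∸ 1) (sym (x∈p⇒∣p∣≡1+∣p-x∣ x∈p))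

  x∉p⇒∣p∪⁅x⁆∣≡1+∣p∣ : ∀ {n} (p : Subset n) x → x ∉ p → ∣ p ∪ ⁅ x ⁆ ∣ ≡ suc ∣ p ∣
  x∉p⇒∣p∪⁅x⁆∣≡1+∣p∣ (inside  ∷ p) zero    x∉p = contradiction here x∉p
  x∉p⇒∣p∪⁅x⁆∣≡1+∣p∣ (outside ∷ p) zero    _   = cong (suc ∘ ∣_∣) (∪-identityʳ p)
  x∉p⇒∣p∪⁅x⁆∣≡1+∣p∣ (inside  ∷ p) (suc x) x∉p = cong suc (x∉p⇒∣p∪⁅x⁆∣≡1+∣p∣ p x (x∉p ∘ there))
  x∉p⇒∣p∪⁅x⁆∣≡1+∣p∣ (outside ∷ p) (suc x) x∉p = x∉p⇒∣p∪⁅x⁆∣≡1+∣p∣ p x (x∉p ∘ there)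

  ∣p∩q∣+∣p∪q∣≡∣p∣+∣q∣ : ∀ {n} (p q : Subset n) → ∣ p ∩ q ∣ + ∣ p ∪ q ∣ ≡ ∣ p ∣ + ∣ q ∣
  ∣p∩q∣+∣p∪q∣≡∣p∣+∣q∣ []            []            = refl
  ∣p∩q∣+∣p∪q∣≡∣p∣+∣q∣ (inside  ∷ p) (inside  ∷ q) =
    cong suc (trans (+-suc _ _) (trans (cong suc (∣p∩q∣+∣p∪q∣≡∣p∣+∣q∣ p q)) (sym (+-suc _ _))))
  ∣p∩q∣+∣p∪q∣≡∣p∣+∣q∣ (inside  ∷ p) (outside ∷ q) =
    trans (+-suc _ _) (cong suc (∣p∩q∣+∣p∪q∣≡∣p∣+∣q∣ p q))
  ∣p∩q∣+∣p∪q∣≡∣p∣+∣q∣ (outside ∷ p) (inside  ∷ q) =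
    trans (+-suc _ _) (trans (cong suc (∣p∩q∣+∣p∪q∣≡∣p∣+∣q∣ p q)) (sym (+-suc _ _)))
  ∣p∩q∣+∣p∪q∣≡∣p∣+∣q∣ (outside ∷ p) (outside ∷ q) = ∣p∩q∣+∣p∪q∣≡∣p∣+∣q∣ p q

  ∣p∣<∣q∣⇒∃[x∈q─p] : ∀ {n} (p q : Subset n) → ∣ p ∣ < ∣ q ∣ → ∃[ x ] x ∈ q × x ∉ p
  ∣p∣<∣q∣⇒∃[x∈q─p] (s ∷ p) (outside ∷ q) ∣p∣<∣q∣ =
    let x , x∈q , x∉p = ∣p∣<∣q∣⇒∃[x∈q─p] p q (≤-<-trans (∣p∣≤∣x∷p∣ s p) ∣p∣<∣q∣)
    in suc x , there x∈q , λ { (there x∈p) → x∉p x∈p }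
  ∣p∣<∣q∣⇒∃[x∈q─p] (outside ∷ p) (inside ∷ q) _ = zero , here , λ ()
  ∣p∣<∣q∣⇒∃[x∈q─p] (inside ∷ p) (inside ∷ q) (s≤s ∣p∣<∣q∣) =
    let x , x∈q , x∉p = ∣p∣<∣q∣⇒∃[x∈q─p] p q ∣p∣<∣q∣
    in suc x , there x∈q , λ { (there x∈p) → x∉p x∈p }

  0<∣p∣⇒Nonempty : ∀ {n} (p : Subset n) → 0 < ∣ p ∣ → Nonempty p
  0<∣p∣⇒Nonempty {n} p 0<∣p∣ =
    let x , x∈p , _ = ∣p∣<∣q∣⇒∃[x∈q─p] ⊥ p (subst (_< ∣ p ∣) (sym (∣⊥∣≡0 n)) 0<∣p∣)
    in x , x∈p

  x∈p─q⁻ : ∀ {n} {x : Fin n} (p q : Subset n) → x ∈ p ─ q → x ∈ p × x ∉ q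
  x∈p─q⁻ (inside  ∷ p) (outside ∷ q) here = here , λ ()
  x∈p─q⁻ {x = zero} (outside ∷ p) (inside  ∷ q) ()
  x∈p─q⁻ {x = zero} (outside ∷ p) (outside ∷ q) ()
  x∈p─q⁻ (_ ∷ p) (_ ∷ q) (there x∈p─q) =
    let x∈p , x∉q = x∈p─q⁻ p q x∈p─q in there x∈p , λ { (there x∈q) → x∉q x∈q }

  x∈p-y⇒x≢y : ∀ {n} {p : Subset n} {x y} → x ∈ p - y → x ≢ y
  x∈p-y⇒x≢y {p = p} {y = y} x∈p-y = x∉⁅y⁆⇒x≢y (proj₂ (x∈p─q⁻ p ⁅ y ⁆ x∈p-y))

  x∉p∧x≢y⇒x∉p∪⁅y⁆ : ∀ {n} {p : Subset n} {x y} → x ∉ p → x ≢ y → x ∉ p ∪ ⁅ y ⁆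
  x∉p∧x≢y⇒x∉p∪⁅y⁆ {p = p} {y = y} x∉p x≢y =
    [ x∉p , x≢y ∘ x∈⁅y⁆⇒x≡y y ]′ ∘ x∈p∪q⁻ p ⁅ y ⁆

  x∈p-y∪⁅z⁆⁻ : ∀ {n} {p : Subset n} {x y z} → x ∈ (p - y) ∪ ⁅ z ⁆ → (x ∈ p × x ≢ y) ⊎ x ≡ z
  x∈p-y∪⁅z⁆⁻ {p = p} {y = y} {z} x∈ with x∈p∪q⁻ (p - y) ⁅ z ⁆ x∈
  ... | inj₁ x∈p-y = inj₁ (p─q⊆p p ⁅ y ⁆ x∈p-y , x∈p-y⇒x≢y x∈p-y)
  ... | inj₂ x∈⁅z⁆ = inj₂ (x∈⁅y⁆⇒x≡y z x∈⁅z⁆)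

module LatticePaths where

  open import Data.Nat using (ℕ; zero; suc; _+_; _*_; _<_; _!; z<s)
  open import Data.Nat.Properties
  open import Data.Nat.Tactic.RingSolver using (solve-∀)
  open import Relation.Binary.PropositionalEquality

  -- latticePaths a r = binom(a + r, r)
  latticePaths : ℕ → ℕ → ℕ
  latticePaths a       zero    = 1
  latticePaths zero    (suc r) = 1
  latticePaths (suc a) (suc r) = latticePaths (suc a) r + latticePaths a (suc r)

  latticePaths>0 : ∀ a r → 0 < latticePaths a r
  latticePaths>0 a       zero    = z<s
  latticePaths>0 zero    (suc r) = z<s
  latticePaths>0 (suc a) (suc r) = <-≤-trans (latticePaths>0 (suc a) r) (m≤m+n _ _)

  latticePaths-! : ∀ a r → latticePaths a r * (a ! * r !) ≡ (a + r) !
  latticePaths-! a       zero    =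
    trans (+-identityʳ _) (trans (*-identityʳ (a !)) (cong _! (sym (+-identityʳ a))))
  latticePaths-! zero    (suc r) = trans (*-identityˡ _) (*-identityˡ _)
  latticePaths-! (suc a) (suc r) = begin
    (P₁ + P₂) * (suc a ! * suc r !)                               ≡⟨ regroup P₁ P₂ a r (a !) (r !) ⟩
    P₁ * (suc a ! * r !) * suc r + P₂ * (a ! * suc r !) * suc a   ≡⟨ cong₂ (λ u w → u * suc r + w * suc a)
                                                                       (latticePaths-! (suc a) r) (latticePaths-! a (suc r)) ⟩
    suc (a + r) ! * suc r + (a + suc r) ! * suc a                 ≡⟨ cong (λ t → suc (a + r) ! * suc r + t ! * suc a) (+-suc a r) ⟩
    suc (a + r) ! * suc r + suc (a + r) ! * suc a                 ≡⟨ collect (suc (a + r) !) a r ⟩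
    suc (suc (a + r)) * suc (a + r) !                             ≡⟨ cong _! (cong suc (sym (+-suc a r))) ⟩
    (suc a + suc r) !                                             ∎
    where
    open ≡-Reasoning
    P₁ = latticePaths (suc a) r
    P₂ = latticePaths a (suc r)
    regroup : ∀ p₁ p₂ a r fa fr → (p₁ + p₂) * ((suc a * fa) * (suc r * fr)) ≡
              p₁ * ((suc a * fa) * fr) * suc r + p₂ * (fa * (suc r * fr)) * suc a
    regroup = solve-∀
    collect : ∀ w a r → w * suc r + w * suc a ≡ suc (suc (a + r)) * w
    collect = solve-∀

  latticePaths-suc : ∀ a r → latticePaths a (suc r) * suc r ≡ latticePaths a r * suc (a + r)
  latticePaths-suc a r = *-cancelʳ-≡ _ _ (a ! * r !) {{m*n≢0 (a !) (r !) {{a !≢0}} {{r !≢0}}}} (begin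
    latticePaths a (suc r) * suc r * (a ! * r !)    ≡⟨ shuffle (latticePaths a (suc r)) (suc r) (a !) (r !) ⟩
    latticePaths a (suc r) * (a ! * suc r !)        ≡⟨ latticePaths-! a (suc r) ⟩
    (a + suc r) !                                   ≡⟨ cong _! (+-suc a r) ⟩
    suc (a + r) * (a + r) !                         ≡⟨ cong (suc (a + r) *_) (sym (latticePaths-! a r)) ⟩
    suc (a + r) * (latticePaths a r * (a ! * r !))  ≡⟨ shuffle′ (suc (a + r)) (latticePaths a r) (a ! * r !) ⟩
    latticePaths a r * suc (a + r) * (a ! * r !)    ∎)
    where
    open ≡-Reasoning
    shuffle : ∀ p s fa fr → p * s * (fa * fr) ≡ p * (fa * (s * fr))
    shuffle = solve-∀
    shuffle′ : ∀ s p f → s * (p * f) ≡ p * s * f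
    shuffle′ = solve-∀

module TightComponents where

  open FiniteSubsets
  open LatticePaths using (latticePaths)
  open import Data.Bool using (true)
  open import Data.Empty using (⊥-elim)
  open import Data.Fin using (Fin) renaming (_≟_ to _≟ᶠ_)
  open import Data.Fin.Subset
  open import Data.Fin.Subset.Properties
  open import Data.List using (List; []; _∷_; _++_; length; allFin)
  open import Data.List.Extrema.Nat using (argmin; f[argmin]≤f[xs])
  open import Data.List.Membership.Propositional.Properties using (∈-allFin)
  open import Data.List.Properties using (length-++)
  open import Data.List.Relation.Binary.Disjoint.Propositional using (Disjoint)
  open import Data.List.Relation.Unary.All as All using (All; []; _∷_)
  import Data.List.Relation.Unary.All.Properties as All
  open import Data.List.Relation.Unary.AllPairs using ([]; _∷_)
  open import Data.List.Relation.Unary.Unique.Propositional using (Unique)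
  import Data.List.Relation.Unary.Unique.Propositional.Properties as Unique
  open import Data.Nat using (ℕ; zero; suc; _+_; _*_; _∸_; _≤_; _<_; z≤n; s≤s⁻¹; z<s)
  open import Data.Nat.Properties
  open import Data.Nat.Tactic.RingSolver using (solve-∀)
  open import Data.Product using (Σ; ∃-syntax; _×_; _,_; proj₁; proj₂; map₂)
  open import Data.Sum using (inj₁; inj₂; [_,_]′)
  open import Data.Vec using (tabulate)
  open import Data.Vec.Properties using ([]=⇒lookup; lookup∘tabulate)
  open import Function using (_∘_)
  open import Relation.Binary.Construct.Closure.ReflexiveTransitive using (ε; _◅_; _◅◅_)
  open import Relation.Binary.PropositionalEquality
  open import Relation.Nullary using (yes; no; contradiction)

  Nbhd : ∀ {n} → Graph n → Fin n → Subset n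
  Nbhd G v = tabulate (adj G v)

  ∈Nbhd⇒adj : ∀ {n} (G : Graph n) {v w} → w ∈ Nbhd G v → adj G v w ≡ true
  ∈Nbhd⇒adj G {v} {w} w∈N = trans (sym (lookup∘tabulate (adj G v) w)) ([]=⇒lookup w∈N)

  minimumDegree : ∀ {n} (G : Graph n) → Fin n → Σ (Fin n) λ u → ∀ v → deg G u ≤ deg G v
  minimumDegree {n} G v₀ =
    argmin (deg G) v₀ (allFin n) , λ v → All.lookup (f[argmin]≤f[xs] v₀ (allFin n)) (∈-allFin v)

  CommonNeighbours : ∀ {n} → Graph n → Subset n → Subset n → Set
  CommonNeighbours G R C = ∀ {u w} → u ∈ R → w ∈ C → adj G u w ≡ true

  module _ {n} (G : Graph n) {d : ℕ} (deg+d≥n : ∀ v → n ≤ deg G v + d) where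

    commonNeighbours-large : ∀ R → ∃[ C ] CommonNeighbours G R C × n ≤ ∣ C ∣ + ∣ R ∣ * d
    commonNeighbours-large R = go ∣ R ∣ R refl
      where
      go : ∀ j R → ∣ R ∣ ≡ j → ∃[ C ] CommonNeighbours G R C × n ≤ ∣ C ∣ + j * d
      go zero    R ∣R∣≡0 =
        ⊤ , (λ u∈R _ → ⊥-elim (n≮0 (<-≤-trans (x∈p⇒∣p-x∣<∣p∣ u∈R) (≤-reflexive ∣R∣≡0)))) ,
        ≤-reflexive (sym (trans (+-identityʳ _) (∣⊤∣≡n n)))
      go (suc j) R ∣R∣≡1+j with 0<∣p∣⇒Nonempty R (subst (0 <_) (sym ∣R∣≡1+j) z<s)
      ... | u , u∈R with go j (R - u) (suc-injective (trans (sym (x∈p⇒∣p∣≡1+∣p-x∣ u∈R)) ∣R∣≡1+j))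
      ... | C , C-adj , n≤∣C∣+jd = C ∩ N , C∩N-adj , bound
        where
        N = Nbhd G u
        C∩N-adj : CommonNeighbours G R (C ∩ N)
        C∩N-adj {u′} u′∈R w∈C∩N with x∈p∩q⁻ C N w∈C∩N | u′ ≟ᶠ u
        ... | _   , w∈N | yes refl = ∈Nbhd⇒adj G w∈N
        ... | w∈C , _   | no u′≢u  = C-adj (x∈p∧x≢y⇒x∈p-y u′∈R u′≢u) w∈C
        bound : n ≤ ∣ C ∩ N ∣ + (d + j * d)
        bound = +-cancelˡ-≤ n _ _ (begin
          n + n                                   ≤⟨ +-mono-≤ n≤∣C∣+jd (deg+d≥n u) ⟩
          (∣ C ∣ + j * d) + (∣ N ∣ + d)           ≡⟨ interchange (∣ C ∣) (j * d) (∣ N ∣) d ⟩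
          (∣ C ∣ + ∣ N ∣) + (d + j * d)           ≡⟨ cong (_+ (d + j * d)) (sym (∣p∩q∣+∣p∪q∣≡∣p∣+∣q∣ C N)) ⟩
          (∣ C ∩ N ∣ + ∣ C ∪ N ∣) + (d + j * d)   ≤⟨ +-monoˡ-≤ (d + j * d) (+-monoʳ-≤ ∣ C ∩ N ∣ (∣p∣≤n (C ∪ N))) ⟩
          (∣ C ∩ N ∣ + n) + (d + j * d)           ≡⟨ swap (∣ C ∩ N ∣) n (d + j * d) ⟩
          n + (∣ C ∩ N ∣ + (d + j * d))           ∎)
          where
          open ≤-Reasoning
          interchange : ∀ a b c e → (a + b) + (c + e) ≡ (a + c) + (e + b)
          interchange = solve-∀
          swap : ∀ a b c → (a + b) + c ≡ b + (a + c)
          swap = solve-∀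

  module _ {n} {G : Graph n} {k : ℕ} {S C : Subset n} {v y : Fin n}
           (S-clique : IsKClique G k S) (v∈S : v ∈ S)
           (C-adj : CommonNeighbours G (S - v) C) (y∈C : y ∈ C) (y≢v : y ≢ v) where

    private
      y∉S-v : y ∉ S - v
      y∉S-v y∈S-v with trans (sym (C-adj y∈S-v y∈C)) (irrefl G y)
      ... | ()

      exchange-clique : IsKClique G k ((S - v) ∪ ⁅ y ⁆)
      exchange-clique =
        trans (x∉p⇒∣p∪⁅x⁆∣≡1+∣p∣ (S - v) y y∉S-v) (trans (sym (x∈p⇒∣p∣≡1+∣p-x∣ v∈S)) (proj₁ S-clique)) ,
        adjacent
        where
        adjacent : ∀ u w → u ∈ (S - v) ∪ ⁅ y ⁆ → w ∈ (S - v) ∪ ⁅ y ⁆ → u ≢ w → adj G u w ≡ true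
        adjacent u w u∈ w∈ u≢w with x∈p-y∪⁅z⁆⁻ u∈ | x∈p-y∪⁅z⁆⁻ w∈
        ... | inj₁ (u∈S , _)   | inj₁ (w∈S , _)   = proj₂ S-clique u w u∈S w∈S u≢w
        ... | inj₁ (u∈S , u≢v) | inj₂ refl        = C-adj (x∈p∧x≢y⇒x∈p-y u∈S u≢v) y∈C
        ... | inj₂ refl        | inj₁ (w∈S , w≢v) = trans (adj-sym G y w) (C-adj (x∈p∧x≢y⇒x∈p-y w∈S w≢v) y∈C)
        ... | inj₂ refl        | inj₂ refl        = contradiction refl u≢w

      S∩exchange≡S-v : S ∩ ((S - v) ∪ ⁅ y ⁆) ≡ S - v
      S∩exchange≡S-v = ⊆-antisym ⊆S-v S-v⊆
        where
        ⊆S-v : S ∩ ((S - v) ∪ ⁅ y ⁆) ⊆ S - v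
        ⊆S-v x∈ with x∈p∩q⁻ S _ x∈
        ... | x∈S , x∈S′ with x∈p-y∪⁅z⁆⁻ x∈S′
        ... | inj₁ (_ , x≢v) = x∈p∧x≢y⇒x∈p-y x∈S x≢v
        ... | inj₂ refl      = contradiction (x∈p∧x≢y⇒x∈p-y x∈S y≢v) y∉S-v
        S-v⊆ : S - v ⊆ S ∩ ((S - v) ∪ ⁅ y ⁆)
        S-v⊆ x∈S-v = x∈p∩q⁺ (p─q⊆p S ⁅ v ⁆ x∈S-v , x∈p∪q⁺ (inj₁ x∈S-v))

    exchange-tightAdj : TightAdj G k S ((S - v) ∪ ⁅ y ⁆)
    exchange-tightAdj = S-clique , exchange-clique ,
      trans (cong ∣_∣ S∩exchange≡S-v) (trans (x∈p⇒∣p-x∣≡∣p∣∸1 v∈S) (cong (_∸ 1) (proj₁ S-clique)))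

  Avoids : ∀ {n} → Subset n → Subset n → Set
  Avoids T X = ∀ {x} → x ∈ T → x ∉ X

  module Enumeration {n} (G : Graph n) (k : ℕ) (e : Subset n) where

    Admissible : Subset n → Subset n → Subset n → Set
    Admissible F X T = InTightComponent G k e T × F ⊆ T × Avoids T X

    DistinctAdmissible : Subset n → Subset n → ℕ → Set
    DistinctAdmissible F X m =
      Σ (List (Subset n)) λ L → Unique L × All (Admissible F X) L × m ≤ length L

    CodegreeAbove : Subset n → ℕ → Set
    CodegreeAbove X a = ∀ R → ∣ R ∣ ≡ k ∸ 1 → ∃[ C ] CommonNeighbours G R C × a < ∣ C ─ X ∣

    codegreeAbove-∪⁅⁆ : ∀ {X a} v → CodegreeAbove X (suc a) → CodegreeAbove (X ∪ ⁅ v ⁆) a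
    codegreeAbove-∪⁅⁆ {X} v codegree R ∣R∣ =
      let C , C-adj , 1+a<∣C─X∣ = codegree R ∣R∣
      in C , C-adj , s≤s⁻¹ (≤-trans 1+a<∣C─X∣ (≤-trans (∣p∣≤1+∣p-x∣ (C ─ X) v)
                                 (≤-reflexive (cong (suc ∘ ∣_∣) (p─q─r≡p─q∪r C X ⁅ v ⁆)))))

    singleton : ∀ {F X S} → Admissible F X S → DistinctAdmissible F X 1
    singleton {S = S} S-adm = S ∷ [] , [] ∷ [] , S-adm ∷ [] , ≤-refl

    append : ∀ {F X m₁ m₂} v → DistinctAdmissible (F ∪ ⁅ v ⁆) X m₁ → DistinctAdmissible F (X ∪ ⁅ v ⁆) m₂ →
             DistinctAdmissible F X (m₁ + m₂)
    append {F} {X} v (L₁ , L₁-unique , L₁-adm , m₁≤) (L₂ , L₂-unique , L₂-adm , m₂≤) =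
      L₁ ++ L₂ , Unique.++⁺ L₁-unique L₂-unique disjoint ,
      All.++⁺ (All.map weaken₁ L₁-adm) (All.map weaken₂ L₂-adm) ,
      ≤-trans (+-mono-≤ m₁≤ m₂≤) (≤-reflexive (sym (length-++ L₁)))
      where
      weaken₁ : ∀ {T} → Admissible (F ∪ ⁅ v ⁆) X T → Admissible F X T
      weaken₁ (T∈comp , F∪v⊆T , T-avoids) = T∈comp , F∪v⊆T ∘ p⊆p∪q ⁅ v ⁆ , T-avoids
      weaken₂ : ∀ {T} → Admissible F (X ∪ ⁅ v ⁆) T → Admissible F X T
      weaken₂ (T∈comp , F⊆T , T-avoids) = T∈comp , F⊆T , λ x∈T → T-avoids x∈T ∘ p⊆p∪q ⁅ v ⁆
      disjoint : Disjoint L₁ L₂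
      disjoint (T∈L₁ , T∈L₂) =
        proj₂ (proj₂ (All.lookup L₂-adm T∈L₂)) (proj₁ (proj₂ (All.lookup L₁-adm T∈L₁)) (x∈p∪q⁺ (inj₂ (x∈⁅x⁆ v))))
          (x∈p∪q⁺ (inj₂ (x∈⁅x⁆ v)))

    Enumerable : ℕ → ℕ → Set
    Enumerable r a = ∀ {S F X} → IsKClique G k S → Admissible F X S → ∣ F ∣ + r ≡ k →
                     CodegreeAbove X a → DistinctAdmissible F X (latticePaths a r)

    enumerable-step : ∀ {r a} → Enumerable r (suc a) → Enumerable (suc r) a → Enumerable (suc r) (suc a)
    enumerable-step {r} fix-v forbid-v {S} {F} {X} S-clique (S∈comp , F⊆S , S-avoids) ∣F∣+1+r≡k codegree
      with ∣p∣<∣q∣⇒∃[x∈q─p] F S (subst (∣ F ∣ <_) (trans ∣F∣+1+r≡k (sym (proj₁ S-clique))) (m<m+n ∣ F ∣ z<s))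
    ... | v , v∈S , v∉F
      with codegreeAbove-∪⁅⁆ v codegree (S - v) (trans (x∈p⇒∣p-x∣≡∣p∣∸1 v∈S) (cong (_∸ 1) (proj₁ S-clique)))
    ... | C , C-adj , a<∣C─X∪v∣
      with 0<∣p∣⇒Nonempty (C ─ (X ∪ ⁅ v ⁆)) (≤-<-trans z≤n a<∣C─X∪v∣)
    ... | y , y∈C─X∪v =
      append v (fix-v S-clique (S∈comp , F∪v⊆S , S-avoids) ∣F∪v∣+r≡k codegree)
               (forbid-v (proj₁ (proj₂ tight)) (S∈comp ◅◅ tight ◅ ε , F⊆S′ , S′-avoids) ∣F∣+1+r≡k
                         (codegreeAbove-∪⁅⁆ v codegree))
      where
      F∪v⊆S : F ∪ ⁅ v ⁆ ⊆ S
      F∪v⊆S = [ F⊆S , (λ x∈⁅v⁆ → subst (_∈ S) (sym (x∈⁅y⁆⇒x≡y v x∈⁅v⁆)) v∈S) ]′ ∘ x∈p∪q⁻ F ⁅ v ⁆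
      ∣F∪v∣+r≡k : ∣ F ∪ ⁅ v ⁆ ∣ + r ≡ k
      ∣F∪v∣+r≡k = trans (cong (_+ r) (x∉p⇒∣p∪⁅x⁆∣≡1+∣p∣ F v v∉F)) (trans (sym (+-suc ∣ F ∣ r)) ∣F∣+1+r≡k)
      y∈C = proj₁ (x∈p─q⁻ C (X ∪ ⁅ v ⁆) y∈C─X∪v)
      y∉X∪v = proj₂ (x∈p─q⁻ C (X ∪ ⁅ v ⁆) y∈C─X∪v)
      tight : TightAdj G k S ((S - v) ∪ ⁅ y ⁆)
      tight = exchange-tightAdj {G = G} S-clique v∈S C-adj y∈C (x∉⁅y⁆⇒x≢y (y∉X∪v ∘ x∈p∪q⁺ ∘ inj₂))
      F⊆S′ : F ⊆ (S - v) ∪ ⁅ y ⁆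
      F⊆S′ x∈F = x∈p∪q⁺ (inj₁ (x∈p∧x≢y⇒x∈p-y (F⊆S x∈F) (λ x≡v → v∉F (subst (_∈ F) x≡v x∈F))))
      S′-avoids : Avoids ((S - v) ∪ ⁅ y ⁆) (X ∪ ⁅ v ⁆)
      S′-avoids x∈S′ with x∈p-y∪⁅z⁆⁻ x∈S′
      ... | inj₁ (x∈S , x≢v) = x∉p∧x≢y⇒x∉p∪⁅y⁆ (S-avoids x∈S) x≢v
      ... | inj₂ refl        = y∉X∪v

    enumerable : ∀ r a → Enumerable r a
    enumerable zero    a       _ S-adm _ _ = singleton S-adm
    enumerable (suc r) zero    _ S-adm _ _ = singleton S-adm
    enumerable (suc r) (suc a) = enumerable-step (enumerable r (suc a)) (enumerable (suc r) a)

  tightComponent-large : ∀ {n} (G : Graph n) {k a d} {e : Subset n} → (∀ v → n ≤ deg G v + d) →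
    a + (k ∸ 1) * d < n → IsKClique G k e →
    Σ (List (Subset n)) λ T → Unique T × All (InTightComponent G k e) T × latticePaths a k ≤ length T
  tightComponent-large {n} G {k} {a} {d} {e} deg+d≥n a+[k-1]d<n e-clique =
    let T , T-unique , T-adm , count =
          enumerable k a e-clique (ε , ⊥⊆ , λ _ → ∉⊥) (cong (_+ k) (∣⊥∣≡0 n)) codegree
    in T , T-unique , All.map proj₁ T-adm , count
    where
    open Enumeration G k e
    codegree : CodegreeAbove ⊥ a
    codegree R ∣R∣≡k-1 = map₂ (λ {C} → map₂ (a<∣C─⊥∣ {C})) (commonNeighbours-large G deg+d≥n R)
      where
      a<∣C─⊥∣ : ∀ {C} → n ≤ ∣ C ∣ + ∣ R ∣ * d → a < ∣ C ─ ⊥ ∣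
      a<∣C─⊥∣ {C} n≤∣C∣+∣R∣d = subst (a <_) (cong ∣_∣ (sym (p─⊥≡p C)))
        (+-cancelʳ-≤ ((k ∸ 1) * d) (suc a) ∣ C ∣
          (≤-trans a+[k-1]d<n (subst (λ j → n ≤ ∣ C ∣ + j * d) ∣R∣≡k-1 n≤∣C∣+∣R∣d)))

module RationalEstimates where

  open LatticePaths using (latticePaths; latticePaths>0; latticePaths-suc)
  open import Data.Nat as ℕ using (ℕ; zero; suc)
  import Data.Nat.Properties as ℕ
  open import Data.Integer as ℤ using (+_)
  import Data.Integer.Properties as ℤ
  import Data.Integer.Tactic.RingSolver as ℤ
  open import Data.Rational
  open import Data.Rational.Properties
  open import Data.Rational.Unnormalised.Base using (mkℚᵘ; *≡*)
  import Data.Rational.Unnormalised.Properties as ℚᵘ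
  open import Data.Sum using (inj₁; inj₂)
  open import Level using (0ℓ)
  open import Relation.Binary.PropositionalEquality
  open import Relation.Nullary.Decidable using (dec⇒maybe)
  open import Tactic.RingSolver using (solve-∀)
  open import Tactic.RingSolver.Core.AlmostCommutativeRing using (AlmostCommutativeRing; fromCommutativeRing)

  ℚ-ring : AlmostCommutativeRing 0ℓ 0ℓ
  ℚ-ring = fromCommutativeRing +-*-commutativeRing (λ p → dec⇒maybe (0ℚ ≟ p))

  ℕtoℚ-suc : ∀ m → ℕtoℚ (suc m) ≡ 1ℚ + ℕtoℚ m
  ℕtoℚ-suc m = toℚᵘ-injective (ℚᵘ.≃-trans (toℚᵘ-fromℚᵘ (mkℚᵘ (+ suc m) 0)) (ℚᵘ.≃-trans (*≡* (ℤ-identity (+ m)))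
    (ℚᵘ.≃-sym (ℚᵘ.≃-trans (toℚᵘ-homo-+ 1ℚ (ℕtoℚ m))
      (ℚᵘ.+-cong (toℚᵘ-fromℚᵘ (mkℚᵘ (+ 1) 0)) (toℚᵘ-fromℚᵘ (mkℚᵘ (+ m) 0)))))))
    where
    ℤ-identity : ∀ z → (+ 1 ℤ.+ z) ℤ.* + 1 ≡ (+ 1 ℤ.* + 1 ℤ.+ z ℤ.* + 1) ℤ.* + 1
    ℤ-identity = ℤ.solve-∀

  ℕtoℚ-+ : ∀ a b → ℕtoℚ (a ℕ.+ b) ≡ ℕtoℚ a + ℕtoℚ b
  ℕtoℚ-+ zero    b = sym (+-identityˡ (ℕtoℚ b))
  ℕtoℚ-+ (suc a) b = begin
    ℕtoℚ (suc (a ℕ.+ b))         ≡⟨ ℕtoℚ-suc (a ℕ.+ b) ⟩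
    1ℚ + ℕtoℚ (a ℕ.+ b)          ≡⟨ cong (λ t → 1ℚ + t) (ℕtoℚ-+ a b) ⟩
    1ℚ + (ℕtoℚ a + ℕtoℚ b)       ≡⟨ sym (+-assoc 1ℚ (ℕtoℚ a) (ℕtoℚ b)) ⟩
    (1ℚ + ℕtoℚ a) + ℕtoℚ b       ≡⟨ cong (_+ ℕtoℚ b) (sym (ℕtoℚ-suc a)) ⟩
    ℕtoℚ (suc a) + ℕtoℚ b        ∎
    where open ≡-Reasoning

  ℕtoℚ-* : ∀ a b → ℕtoℚ (a ℕ.* b) ≡ ℕtoℚ a * ℕtoℚ b
  ℕtoℚ-* zero    b = sym (*-zeroˡ (ℕtoℚ b))
  ℕtoℚ-* (suc a) b = begin
    ℕtoℚ (b ℕ.+ a ℕ.* b)         ≡⟨ ℕtoℚ-+ b (a ℕ.* b) ⟩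
    ℕtoℚ b + ℕtoℚ (a ℕ.* b)      ≡⟨ cong (λ t → ℕtoℚ b + t) (ℕtoℚ-* a b) ⟩
    ℕtoℚ b + ℕtoℚ a * ℕtoℚ b     ≡⟨ expand (ℕtoℚ a) (ℕtoℚ b) ⟩
    (1ℚ + ℕtoℚ a) * ℕtoℚ b       ≡⟨ cong (_* ℕtoℚ b) (sym (ℕtoℚ-suc a)) ⟩
    ℕtoℚ (suc a) * ℕtoℚ b        ∎
    where
    open ≡-Reasoning
    expand : ∀ p q → q + p * q ≡ (1ℚ + p) * q
    expand = solve-∀ ℚ-ring

  ℕtoℚ-nonNeg : ∀ m → 0ℚ ≤ ℕtoℚ m
  ℕtoℚ-nonNeg m = nonNegative⁻¹ (ℕtoℚ m) {{normalize-nonNeg m 1}}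

  ℕtoℚ-mono-≤ : ∀ {a b} → a ℕ.≤ b → ℕtoℚ a ≤ ℕtoℚ b
  ℕtoℚ-mono-≤ {a} {b} a≤b = begin
    ℕtoℚ a                       ≡⟨ sym (+-identityʳ (ℕtoℚ a)) ⟩
    ℕtoℚ a + 0ℚ                  ≤⟨ +-monoʳ-≤ (ℕtoℚ a) (ℕtoℚ-nonNeg (b ℕ.∸ a)) ⟩
    ℕtoℚ a + ℕtoℚ (b ℕ.∸ a)      ≡⟨ sym (ℕtoℚ-+ a (b ℕ.∸ a)) ⟩
    ℕtoℚ (a ℕ.+ (b ℕ.∸ a))       ≡⟨ cong ℕtoℚ (ℕ.m+[n∸m]≡n a≤b) ⟩
    ℕtoℚ b                       ∎
    where open ≤-Reasoning

  ℕtoℚ-mono-< : ∀ {a b} → a ℕ.< b → ℕtoℚ a < ℕtoℚ b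
  ℕtoℚ-mono-< {a} a<b = begin-strict
    ℕtoℚ a                       ≡⟨ sym (+-identityˡ (ℕtoℚ a)) ⟩
    0ℚ + ℕtoℚ a                  <⟨ +-monoˡ-< (ℕtoℚ a) (positive⁻¹ 1ℚ) ⟩
    1ℚ + ℕtoℚ a                  ≡⟨ sym (ℕtoℚ-suc a) ⟩
    ℕtoℚ (suc a)                 ≤⟨ ℕtoℚ-mono-≤ a<b ⟩
    _                            ∎
    where open ≤-Reasoning

  ℕtoℚ-cancel-< : ∀ {a b} → ℕtoℚ a < ℕtoℚ b → a ℕ.< b
  ℕtoℚ-cancel-< a<b = ℕ.≰⇒> (λ b≤a → <-irrefl refl (<-≤-trans a<b (ℕtoℚ-mono-≤ b≤a)))

  ℕtoℚ-∸≥ : ∀ a b → ℕtoℚ a - ℕtoℚ b ≤ ℕtoℚ (a ℕ.∸ b)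
  ℕtoℚ-∸≥ a b = begin
    ℕtoℚ a - ℕtoℚ b                      ≤⟨ +-monoˡ-≤ (- ℕtoℚ b) (ℕtoℚ-mono-≤ (ℕ.m≤n+m∸n a b)) ⟩
    ℕtoℚ (b ℕ.+ (a ℕ.∸ b)) - ℕtoℚ b      ≡⟨ cong (_- ℕtoℚ b) (ℕtoℚ-+ b (a ℕ.∸ b)) ⟩
    ℕtoℚ b + ℕtoℚ (a ℕ.∸ b) - ℕtoℚ b     ≡⟨ cancel (ℕtoℚ b) (ℕtoℚ (a ℕ.∸ b)) ⟩
    ℕtoℚ (a ℕ.∸ b)                       ∎
    where
    open ≤-Reasoning
    cancel : ∀ p q → p + q - p ≡ q
    cancel = solve-∀ ℚ-ring

  ℕtoℚ-∸ : ∀ {a b} → b ℕ.≤ a → ℕtoℚ (a ℕ.∸ b) ≡ ℕtoℚ a - ℕtoℚ b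
  ℕtoℚ-∸ {a} {b} b≤a = begin
    ℕtoℚ (a ℕ.∸ b)                       ≡⟨ sym (cancel (ℕtoℚ b) (ℕtoℚ (a ℕ.∸ b))) ⟩
    ℕtoℚ b + ℕtoℚ (a ℕ.∸ b) - ℕtoℚ b     ≡⟨ cong (_- ℕtoℚ b) (sym (ℕtoℚ-+ b (a ℕ.∸ b))) ⟩
    ℕtoℚ (b ℕ.+ (a ℕ.∸ b)) - ℕtoℚ b      ≡⟨ cong (λ t → ℕtoℚ t - ℕtoℚ b) (ℕ.m+[n∸m]≡n b≤a) ⟩
    ℕtoℚ a - ℕtoℚ b                      ∎
    where
    open ≡-Reasoning
    cancel : ∀ p q → p + q - p ≡ q
    cancel = solve-∀ ℚ-ring

  ℕtoℚ-*-/ : ∀ m d → ℕtoℚ (suc d) * (+ m / suc d) ≡ ℕtoℚ m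
  ℕtoℚ-*-/ m d = toℚᵘ-injective (ℚᵘ.≃-trans (toℚᵘ-homo-* (ℕtoℚ (suc d)) (+ m / suc d))
    (ℚᵘ.≃-trans (ℚᵘ.*-cong (toℚᵘ-fromℚᵘ (mkℚᵘ (+ suc d) 0)) (toℚᵘ-fromℚᵘ (mkℚᵘ (+ m) d)))
    (ℚᵘ.≃-trans (*≡* ℤ-identity) (ℚᵘ.≃-sym (toℚᵘ-fromℚᵘ (mkℚᵘ (+ m) 0))))))
    where
    ℤ-identity : (+ suc d ℤ.* + m) ℤ.* + 1 ≡ + m ℤ.* + (1 ℕ.* suc d)
    ℤ-identity = trans (ℤ.*-identityʳ _) (trans (ℤ.*-comm (+ suc d) (+ m)) (cong (λ t → + m ℤ.* + t) (sym (ℕ.*-identityˡ (suc d)))))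

  p≤∣p∣ : ∀ p → p ≤ ∣ p ∣
  p≤∣p∣ p with ≤-total p 0ℚ
  ... | inj₁ p≤0 = ≤-trans p≤0 (0≤∣p∣ p)
  ... | inj₂ 0≤p = ≤-reflexive (sym (0≤p⇒∣p∣≡p 0≤p))

  -p<p : ∀ {p} → 0ℚ < p → - p < p
  -p<p 0<p = <-trans (neg-antimono-< 0<p) 0<p

  ∣p-q∣≤p+q : ∀ {p q} → 0ℚ ≤ p → 0ℚ ≤ q → ∣ p - q ∣ ≤ p + q
  ∣p-q∣≤p+q {p} {q} 0≤p 0≤q =
    subst (∣ p - q ∣ ≤_) (cong₂ _+_ (0≤p⇒∣p∣≡p 0≤p) (0≤p⇒∣p∣≡p 0≤q)) (∣p-q∣≤∣p∣+∣q∣ p q)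

  ∣p-q∣<p+q : ∀ {p q} → 0ℚ < p → 0ℚ < q → ∣ p - q ∣ < p + q
  ∣p-q∣<p+q {p} {q} 0<p 0<q with ∣p∣≡p∨∣p∣≡-p (p - q)
  ... | inj₁ ∣p-q∣≡p-q    = subst (_< p + q) (sym ∣p-q∣≡p-q) (+-monoʳ-< p (-p<p 0<q))
  ... | inj₂ ∣p-q∣≡-[p-q] = subst (_< p + q) (trans (negate p q) (sym ∣p-q∣≡-[p-q])) (+-monoˡ-< q (-p<p 0<p))
    where
    negate : ∀ p q → - p + q ≡ - (p - q)
    negate = solve-∀ ℚ-ring

  0<[q-p]*n : ∀ {p q n} → p < q → 0 ℕ.< n → 0ℚ < (q - p) * ℕtoℚ n
  0<[q-p]*n {p} {q} {n} p<q 0<n = subst (_< (q - p) * ℕtoℚ n) (*-zeroˡ (ℕtoℚ n))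
    (*-monoˡ-<-pos (ℕtoℚ n) {{positive (ℕtoℚ-mono-< 0<n)}} (subst (_< q - p) (+-inverseʳ p) (+-monoˡ-< (- p) p<q)))

  module _ {x : ℚ} {a : ℕ} (0<x : 0ℚ < x) (x≤1+a : x ≤ ℕtoℚ (suc a)) where

    private
      P : ℕ → ℚ
      P r = ℕtoℚ (latticePaths a r)

      ι : ℕ → ℚ
      ι r = + 1 / suc r

      ι-pos : ∀ r → Positive (ι r)
      ι-pos r = normalize-pos 1 (suc r)

      ι-nonNeg : ∀ r → NonNegative (ι r)
      ι-nonNeg r = normalize-nonNeg 1 (suc r)

      factor-nonNeg : ∀ r → NonNegative (∣ x - ℕtoℚ r ∣ * ι r)
      factor-nonNeg r = nonNeg*nonNeg⇒nonNeg ∣ x - ℕtoℚ r ∣ {{∣-∣-nonNeg (x - ℕtoℚ r)}} (ι r) {{ι-nonNeg r}}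

      ∣binomℚ-suc∣ : ∀ r → ∣ binomℚ x (suc r) ∣ ≡ ∣ binomℚ x r ∣ * (∣ x - ℕtoℚ r ∣ * ι r)
      ∣binomℚ-suc∣ r = begin
        ∣ binomℚ x r * ((x - ℕtoℚ r) * ι r) ∣        ≡⟨ ∣p*q∣≡∣p∣*∣q∣ (binomℚ x r) _ ⟩
        ∣ binomℚ x r ∣ * ∣ (x - ℕtoℚ r) * ι r ∣      ≡⟨ cong (∣ binomℚ x r ∣ *_) (∣p*q∣≡∣p∣*∣q∣ (x - ℕtoℚ r) (ι r)) ⟩
        ∣ binomℚ x r ∣ * (∣ x - ℕtoℚ r ∣ * ∣ ι r ∣)  ≡⟨ cong (λ t → ∣ binomℚ x r ∣ * (∣ x - ℕtoℚ r ∣ * t)) ∣ι∣≡ι ⟩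
        ∣ binomℚ x r ∣ * (∣ x - ℕtoℚ r ∣ * ι r)      ∎
        where
        open ≡-Reasoning
        ∣ι∣≡ι = 0≤p⇒∣p∣≡p (nonNegative⁻¹ (ι r) {{ι-nonNeg r}})

      P-suc : ∀ r → P (suc r) ≡ P r * (ℕtoℚ (suc (a ℕ.+ r)) * ι r)
      P-suc r = begin
        P (suc r)                                          ≡⟨ sym (*-identityʳ (P (suc r))) ⟩
        P (suc r) * 1ℚ                                     ≡⟨ cong (P (suc r) *_) (sym (ℕtoℚ-*-/ 1 r)) ⟩
        P (suc r) * (ℕtoℚ (suc r) * ι r)                   ≡⟨ sym (*-assoc (P (suc r)) _ _) ⟩
        P (suc r) * ℕtoℚ (suc r) * ι r                     ≡⟨ cong (_* ι r) (sym (ℕtoℚ-* (latticePaths a (suc r)) (suc r))) ⟩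
        ℕtoℚ (latticePaths a (suc r) ℕ.* suc r) * ι r      ≡⟨ cong (λ t → ℕtoℚ t * ι r) (latticePaths-suc a r) ⟩
        ℕtoℚ (latticePaths a r ℕ.* suc (a ℕ.+ r)) * ι r    ≡⟨ cong (_* ι r) (ℕtoℚ-* (latticePaths a r) (suc (a ℕ.+ r))) ⟩
        P r * ℕtoℚ (suc (a ℕ.+ r)) * ι r                   ≡⟨ *-assoc (P r) _ _ ⟩
        P r * (ℕtoℚ (suc (a ℕ.+ r)) * ι r)                 ∎
        where open ≡-Reasoning

      ∣x-r∣≤1+a+r : ∀ r → ∣ x - ℕtoℚ r ∣ ≤ ℕtoℚ (suc (a ℕ.+ r))
      ∣x-r∣≤1+a+r r = begin
        ∣ x - ℕtoℚ r ∣            ≤⟨ ∣p-q∣≤p+q (<⇒≤ 0<x) (ℕtoℚ-nonNeg r) ⟩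
        x + ℕtoℚ r                ≤⟨ +-monoˡ-≤ (ℕtoℚ r) x≤1+a ⟩
        ℕtoℚ (suc a) + ℕtoℚ r     ≡⟨ sym (ℕtoℚ-+ (suc a) r) ⟩
        ℕtoℚ (suc (a ℕ.+ r))      ∎
        where open ≤-Reasoning

      ∣x-[1+r]∣<1+a+[1+r] : ∀ r → ∣ x - ℕtoℚ (suc r) ∣ < ℕtoℚ (suc (a ℕ.+ suc r))
      ∣x-[1+r]∣<1+a+[1+r] r = begin-strict
        ∣ x - ℕtoℚ (suc r) ∣          <⟨ ∣p-q∣<p+q 0<x (ℕtoℚ-mono-< (ℕ.z<s {r})) ⟩
        x + ℕtoℚ (suc r)              ≤⟨ +-monoˡ-≤ (ℕtoℚ (suc r)) x≤1+a ⟩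
        ℕtoℚ (suc a) + ℕtoℚ (suc r)   ≡⟨ sym (ℕtoℚ-+ (suc a) (suc r)) ⟩
        ℕtoℚ (suc (a ℕ.+ suc r))      ∎
        where open ≤-Reasoning

    ∣binomℚ∣≤latticePaths : ∀ r → ∣ binomℚ x r ∣ ≤ ℕtoℚ (latticePaths a r)
    ∣binomℚ∣≤latticePaths zero    = ≤-refl
    ∣binomℚ∣≤latticePaths (suc r) = begin
      ∣ binomℚ x (suc r) ∣                        ≡⟨ ∣binomℚ-suc∣ r ⟩
      ∣ binomℚ x r ∣ * (∣ x - ℕtoℚ r ∣ * ι r)     ≤⟨ *-monoʳ-≤-nonNeg _ {{factor-nonNeg r}} (∣binomℚ∣≤latticePaths r) ⟩
      P r * (∣ x - ℕtoℚ r ∣ * ι r)                ≤⟨ *-monoˡ-≤-nonNeg (P r) {{nonNegative (ℕtoℚ-nonNeg (latticePaths a r))}}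
                                                       (*-monoʳ-≤-nonNeg (ι r) {{ι-nonNeg r}} (∣x-r∣≤1+a+r r)) ⟩
      P r * (ℕtoℚ (suc (a ℕ.+ r)) * ι r)          ≡⟨ sym (P-suc r) ⟩
      P (suc r)                                   ∎
      where open ≤-Reasoning

    binomℚ<latticePaths : ∀ r → binomℚ x (suc (suc r)) < ℕtoℚ (latticePaths a (suc (suc r)))
    binomℚ<latticePaths r = begin-strict
      binomℚ x (2+r)                                  ≤⟨ p≤∣p∣ (binomℚ x (2+r)) ⟩
      ∣ binomℚ x (2+r) ∣                              ≡⟨ ∣binomℚ-suc∣ (suc r) ⟩
      ∣ binomℚ x (suc r) ∣ * (∣ x - ℕtoℚ (suc r) ∣ * ι (suc r))
                                                      ≤⟨ *-monoʳ-≤-nonNeg _ {{factor-nonNeg (suc r)}} (∣binomℚ∣≤latticePaths (suc r)) ⟩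
      P (suc r) * (∣ x - ℕtoℚ (suc r) ∣ * ι (suc r))  <⟨ *-monoʳ-<-pos (P (suc r)) {{positive (ℕtoℚ-mono-< (latticePaths>0 a (suc r)))}}
                                                           (*-monoˡ-<-pos (ι (suc r)) {{ι-pos (suc r)}} (∣x-[1+r]∣<1+a+[1+r] r)) ⟩
      P (suc r) * (ℕtoℚ (suc (a ℕ.+ suc r)) * ι (suc r)) ≡⟨ sym (P-suc (suc r)) ⟩
      P (2+r)                                         ∎
      where
      open ≤-Reasoning
      2+r = suc (suc r)

  [δ-kfrac]n≤n∸[k-1][n∸D] : ∀ m n D δ → kfrac (suc (suc m)) ≤ δ → δ * ℕtoℚ n ≤ ℕtoℚ D → D ℕ.≤ n →
                  (δ - kfrac (suc (suc m))) * ℕtoℚ n ≤ ℕtoℚ (n ℕ.∸ suc m ℕ.* (n ℕ.∸ D))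
  [δ-kfrac]n≤n∸[k-1][n∸D] m n D δ K≤δ δN≤D D≤n = begin
    x                                    ≡⟨ sym (*-identityˡ x) ⟩
    1ℚ * x                               ≤⟨ *-monoʳ-≤-nonNeg x {{nonNegative 0≤x}} (ℕtoℚ-mono-≤ {1} {suc m} (ℕ.s≤s ℕ.z≤n)) ⟩
    s * x                                ≡⟨ distribute s δ K N ⟩
    s * (δ * N) - s * K * N              ≡⟨ cong (λ t → s * (δ * N) - t * N) (ℕtoℚ-*-/ m m) ⟩
    s * (δ * N) - M * N                  ≤⟨ +-monoˡ-≤ (- (M * N)) (*-monoˡ-≤-nonNeg s {{nonNegative (ℕtoℚ-nonNeg (suc m))}} δN≤D) ⟩
    s * ℕtoℚ D - M * N                   ≡⟨ cong (λ t → t * ℕtoℚ D - M * N) (ℕtoℚ-suc m) ⟩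
    (1ℚ + M) * ℕtoℚ D - M * N            ≡⟨ regroup M (ℕtoℚ D) N ⟩
    N - (1ℚ + M) * (N - ℕtoℚ D)          ≡⟨ cong₂ (λ t u → N - t * u) (sym (ℕtoℚ-suc m)) (sym (ℕtoℚ-∸ D≤n)) ⟩
    N - s * ℕtoℚ (n ℕ.∸ D)               ≡⟨ cong (λ t → N - t) (sym (ℕtoℚ-* (suc m) (n ℕ.∸ D))) ⟩
    N - ℕtoℚ (suc m ℕ.* (n ℕ.∸ D))       ≤⟨ ℕtoℚ-∸≥ n (suc m ℕ.* (n ℕ.∸ D)) ⟩
    ℕtoℚ (n ℕ.∸ suc m ℕ.* (n ℕ.∸ D))     ∎
    where
    open ≤-Reasoning
    K = kfrac (suc (suc m))
    N = ℕtoℚ n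
    M = ℕtoℚ m
    s = ℕtoℚ (suc m)
    x = (δ - K) * N
    0≤x : 0ℚ ≤ x
    0≤x = nonNegative⁻¹ x {{nonNeg*nonNeg⇒nonNeg (δ - K) {{nonNegative 0≤δ-K}} N {{nonNegative (ℕtoℚ-nonNeg n)}}}}
      where
      0≤δ-K : 0ℚ ≤ δ - K
      0≤δ-K = subst (_≤ δ - K) (+-inverseʳ K) (+-monoˡ-≤ (- K) K≤δ)
    distribute : ∀ s δ K N → s * ((δ - K) * N) ≡ s * (δ * N) - s * K * N
    distribute = solve-∀ ℚ-ring
    regroup : ∀ M D N → (1ℚ + M) * D - M * N ≡ N - (1ℚ + M) * (N - D)
    regroup = solve-∀ ℚ-ring

open FiniteSubsets using (0<∣p∣⇒Nonempty)
open TightComponents using (Nbhd; minimumDegree; tightComponent-large)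
open RationalEstimates
open import Data.Fin.Properties using (toℕ<n)
open import Data.Fin.Subset using (Subset)
open import Data.Fin.Subset.Properties using (∣p∣≤n)
open import Data.List using (List; length)
open import Data.List.Relation.Unary.All using (All)
open import Data.List.Relation.Unary.Unique.Propositional using (Unique)
open import Data.Nat using (ℕ; suc; _+_; _≤_; _∸_; z≤n; z<s; s≤s)
import Data.Nat as ℕ
import Data.Nat.Properties as ℕ
open import Data.Product using (Σ; _×_; _,_; proj₁; proj₂)
open import Data.Rational using (ℚ; 0ℚ; _<_; _*_; _-_) renaming (_≤_ to _≤ℚ_)
open import Data.Rational.Properties using (<-≤-trans; <⇒≤)
open import Relation.Binary.PropositionalEquality using (subst; sym; cong; trans)

0<n∸c⇒[n∸c∸1]+c<n : ∀ n c → 0 ℕ.< n ∸ c → (n ∸ c ∸ 1) + c ℕ.< n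
0<n∸c⇒[n∸c∸1]+c<n n c 0<n∸c = ℕ.≤-reflexive (trans (cong (_+ c) (ℕ.m+[n∸m]≡n 0<n∸c))
                                                       (ℕ.m∸n+n≡m (ℕ.<⇒≤ (ℕ.m∸n≢0⇒n<m {n} {c} (ℕ.>⇒≢ 0<n∸c)))))

proposition5p4 : (k : ℕ) → 2 ≤ k → (δ : ℚ) → kfrac k < δ →
    (n : ℕ) → (G : Graph n) → (∀ v → δ * ℕtoℚ n ≤ℚ ℕtoℚ (deg G v)) →
    (e : Subset n) → IsKClique G k e →
    Σ (List (Subset n)) λ T →
    Unique T × All (InTightComponent G k e) T ×
    binomℚ ((δ - kfrac k) * ℕtoℚ n) k < ℕtoℚ (length T)
proposition5p4 (suc (suc m)) (s≤s (s≤s _)) δ K<δ n G δn≤deg e e-clique =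
  let T , T-unique , T-comp , paths≤∣T∣ = tightComponent-large G {a = a} deg+d≥n a+[k-1]d<n e-clique
  in T , T-unique , T-comp , <-≤-trans (binomℚ<latticePaths {a = a} 0<x x≤1+a m) (ℕtoℚ-mono-≤ paths≤∣T∣)
  where
  v₀ = proj₁ (0<∣p∣⇒Nonempty e (subst (0 ℕ.<_) (sym (proj₁ e-clique)) z<s))
  u = proj₁ (minimumDegree G v₀)
  d = n ∸ deg G u
  deg+d≥n : ∀ v → n ≤ deg G v + d
  deg+d≥n v = ℕ.≤-trans (ℕ.m≤n+m∸n n (deg G u)) (ℕ.+-monoˡ-≤ d (proj₂ (minimumDegree G v₀) v))
  x = (δ - kfrac (suc (suc m))) * ℕtoℚ n
  0<x : 0ℚ < x
  0<x = 0<[q-p]*n K<δ (ℕ.≤-<-trans z≤n (toℕ<n v₀))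
  x≤n∸[k-1]d : x ≤ℚ ℕtoℚ (n ∸ suc m ℕ.* d)
  x≤n∸[k-1]d = [δ-kfrac]n≤n∸[k-1][n∸D] m n (deg G u) δ (<⇒≤ K<δ) (δn≤deg u) (∣p∣≤n (Nbhd G u))
  0<n∸[k-1]d : 0 ℕ.< n ∸ suc m ℕ.* d
  0<n∸[k-1]d = ℕtoℚ-cancel-< (<-≤-trans 0<x x≤n∸[k-1]d)
  a = n ∸ suc m ℕ.* d ∸ 1
  x≤1+a : x ≤ℚ ℕtoℚ (suc a)
  x≤1+a = subst (λ t → x ≤ℚ ℕtoℚ t) (sym (ℕ.m+[n∸m]≡n 0<n∸[k-1]d)) x≤n∸[k-1]d
  a+[k-1]d<n : a + suc m ℕ.* d ℕ.< n
  a+[k-1]d<n = 0<n∸c⇒[n∸c∸1]+c<n n (suc m ℕ.* d) 0<n∸[k-1]d
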